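{- Let $Q$ be an $s\times t$ $(0,1)$-matrix that is not all-zero, and let its core $Q_{core}$ be an $s'\times t'$ matrix. If $m-(s-s')\ge 2s'$ and $n-(t-t')\ge 2t'$, then \[\mathrm{m}(m,n,Q)=\bigl(m-(s-s')\bigr)\bigl(n-(t-t')\bigr)-\bigl(|NW(Q_{core})|+|SW(Q_{core})|+|NE(Q_{core})|+|SE(Q_{core})|\bigr).\]
   Context: All matrices are $(0,1)$-matrices. An $m\times n$ matrix $A$ is $Q$-forcing if every $s\times t$ submatrix of $A$ (any $s$ rows and any $t$ columns, order kept) is entrywise $\ge Q$; $\mathrm{m}(m,n,Q)$ is the minimum number of $1$-entries of an $m\times n$ $Q$-forcing matrix. $Q_{core}$ is obtained from $Q$ by deleting all-zero rows from the top and bottom and all-zero columns from the left and right until each of its first row, last row, first column and last column contains a $1$-entry. For a matrix $R$, the corner functions are: $NW(R)$ is the set of positions $(i,j)$ with $R_{i,j}=0$ such that no $1$-entry of $R$ lies at a position $(i',j')$ with $i'\le i$, $j'\le j$; $SW(R)$: same with $i'\ge i$, $j'\le j$; $NE(R)$: same with $i'\le i$, $j'\ge j$; $SE(R)$: same with $i'\ge i$, $j'\ge j$. $|X|$ denotes cardinality. -}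

module Defs where

open import Data.Bool using (Bool; true; false; if_then_else_)
open import Data.Bool.Properties using () renaming (_≟_ to _≟ᵇ_)
open import Data.Nat using (ℕ; zero; suc; _+_; _*_; _∸_; _<?_) renaming (_≤_ to _≤ℕ_; _<_ to _<ℕ_)
open import Data.Fin using (Fin; zero; suc; toℕ; _≤_; _<_; _≤?_)
open import Data.Fin.Properties using (all?)
open import Data.Product using (Σ; ∃; _×_; _,_)
open import Relation.Nullary using (Dec; does)
open import Relation.Nullary.Decidable using (_→-dec_)
open import Relation.Binary.PropositionalEquality using (_≡_)

Matrix : ℕ → ℕ → Set
Matrix m n = Fin m → Fin n → Bool

countFin : ∀ {n} → (Fin n → Bool) → ℕ
countFin {zero}  f = 0
countFin {suc n} f = (if f zero then 1 else 0) + countFin (λ k → f (suc k))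

count2 : ∀ {m n} → (Fin m → Fin n → Bool) → ℕ
count2 {zero}  M = 0
count2 {suc m} M = countFin (M zero) + count2 (λ i → M (suc i))

ones : ∀ {m n} → Matrix m n → ℕ
ones = count2

Increasing : ∀ {s m} → (Fin s → Fin m) → Set
Increasing r = ∀ i j → i < j → r i < r j

SubmatrixGeq : ∀ {m n s t} → Matrix m n → Matrix s t →
               (Fin s → Fin m) → (Fin t → Fin n) → Set
SubmatrixGeq A Q r c = ∀ i j → Q i j ≡ true → A (r i) (c j) ≡ true

QForcing : ∀ {m n s t} → Matrix s t → Matrix m n → Set
QForcing {m} {n} {s} {t} Q A =
  (r : Fin s → Fin m) → (c : Fin t → Fin n) →
  Increasing r → Increasing c → SubmatrixGeq A Q r c

IsMinForcing : (m n : ℕ) → ∀ {s t} → Matrix s t → ℕ → Set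
IsMinForcing m n Q k =
  (Σ (Matrix m n) λ A → QForcing Q A × ones A ≡ k) ×
  (∀ (A : Matrix m n) → QForcing Q A → k ≤ℕ ones A)

NonZero : ∀ {s t} → Matrix s t → Set
NonZero Q = ∃ λ i → ∃ λ j → Q i j ≡ true

entryℕ : ∀ {s t} → Matrix s t → ℕ → ℕ → Bool
entryℕ {s} {t} Q i j = go (i <? s) (j <? t)
  where
  go : Dec (i <ℕ s) → Dec (j <ℕ t) → Bool
  go (Relation.Nullary.yes p) (Relation.Nullary.yes q) =
    Q (Data.Fin.fromℕ< p) (Data.Fin.fromℕ< q)
  go _ _ = false

block : ∀ {s t} → Matrix s t → (a c s' t' : ℕ) → Matrix s' t'
block Q a c s' t' i j = entryℕ Q (a + toℕ i) (c + toℕ j)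

-- (a , c , s' , t') describes the core of Q: the result of deleting zero rows
-- from top/bottom and zero columns from left/right until the first/last
-- row/column each contain a 1.  Namely: rows a .. a+s'-1 and columns
-- c .. c+t'-1 are kept, all deleted rows/columns are zero, and the first row,
-- last row, first column and last column of the kept block contain a 1.
IsCore : ∀ {s t} → Matrix s t → (a c s' t' : ℕ) → Set
IsCore {s} {t} Q a c s' t' =
  (a + s' ≤ℕ s) × (c + t' ≤ℕ t) ×
  (∀ (i : Fin s) (j : Fin t) → Q i j ≡ true →
     (a ≤ℕ toℕ i) × (toℕ i <ℕ a + s') × (c ≤ℕ toℕ j) × (toℕ j <ℕ c + t')) ×
  (∃ λ j → j <ℕ t' × entryℕ Q a (c + j) ≡ true) ×
  (∃ λ j → j <ℕ t' × entryℕ Q (a + (s' ∸ 1)) (c + j) ≡ true) ×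
  (∃ λ i → i <ℕ s' × entryℕ Q (a + i) c ≡ true) ×
  (∃ λ i → i <ℕ s' × entryℕ Q (a + i) (c + (t' ∸ 1)) ≡ true)

NW : ∀ {p q} → Matrix p q → Fin p → Fin q → Set
NW R i j = R i j ≡ false × (∀ i' j' → i' ≤ i → j' ≤ j → R i' j' ≡ false)

SW : ∀ {p q} → Matrix p q → Fin p → Fin q → Set
SW R i j = R i j ≡ false × (∀ i' j' → i ≤ i' → j' ≤ j → R i' j' ≡ false)

NE : ∀ {p q} → Matrix p q → Fin p → Fin q → Set
NE R i j = R i j ≡ false × (∀ i' j' → i' ≤ i → j ≤ j' → R i' j' ≡ false)

SE : ∀ {p q} → Matrix p q → Fin p → Fin q → Set
SE R i j = R i j ≡ false × (∀ i' j' → i ≤ i' → j ≤ j' → R i' j' ≡ false)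

private
  fz? : ∀ {p q} (R : Matrix p q) i j → Dec (R i j ≡ false)
  fz? R i j = R i j ≟ᵇ false

NW? : ∀ {p q} (R : Matrix p q) i j → Dec (NW R i j)
NW? R i j = fz? R i j Relation.Nullary.Decidable.×-dec
  all? (λ i' → all? (λ j' → (i' ≤? i) →-dec ((j' ≤? j) →-dec fz? R i' j')))

SW? : ∀ {p q} (R : Matrix p q) i j → Dec (SW R i j)
SW? R i j = fz? R i j Relation.Nullary.Decidable.×-dec
  all? (λ i' → all? (λ j' → (i ≤? i') →-dec ((j' ≤? j) →-dec fz? R i' j')))

NE? : ∀ {p q} (R : Matrix p q) i j → Dec (NE R i j)
NE? R i j = fz? R i j Relation.Nullary.Decidable.×-dec
  all? (λ i' → all? (λ j' → (i' ≤? i) →-dec ((j ≤? j') →-dec fz? R i' j')))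

SE? : ∀ {p q} (R : Matrix p q) i j → Dec (SE R i j)
SE? R i j = fz? R i j Relation.Nullary.Decidable.×-dec
  all? (λ i' → all? (λ j' → (i ≤? i') →-dec ((j ≤? j') →-dec fz? R i' j')))

card : ∀ {p q} {P : Fin p → Fin q → Set} → (∀ i j → Dec (P i j)) → ℕ
card P? = count2 (λ i j → does (P? i j))

cornerSum : ∀ {p q} → Matrix p q → ℕ
cornerSum R = card (NW? R) + card (SW? R) + card (NE? R) + card (SE? R)

-- Call a position (x, y) of an m×n matrix forced if an increasing choice of rows and
-- columns carries some 1-entry (i, j) of Q there, i.e. i ≤ x ≤ i + (m − s) and
-- j ≤ y ≤ j + (n − t).  The forced positions form a Q-forcing matrix lying inside every
-- Q-forcing matrix, so m(m,n,Q) is their number.  The zero border of Q only shifts these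
-- ranges, so the count equals that for Q_core in an M×N matrix, M = m − (s − s'),
-- N = n − (t − t').  When M ≥ 2s' and N ≥ 2t', the 1s in the first and last rows and
-- columns of the core force every position outside the four s'×t' corner blocks, and a
-- position of, say, the top-left block is unforced exactly when no 1 of the core lies
-- weakly north-west of it, i.e. when it belongs to NW(Q_core).

module Submission where

open import Defs
open import Data.Bool using (Bool; true; false; not; if_then_else_)
open import Data.Bool.Properties using (¬-not) renaming (_≟_ to _≟ᵇ_)
open import Data.Fin using (Fin; toℕ; fromℕ<; inject₁) renaming (zero to fzero; suc to fsuc)
open import Data.Fin.Properties using (any?; toℕ<n; toℕ-fromℕ<; fromℕ<-toℕ; toℕ-injective; toℕ-inject₁)
open import Data.Nat using (ℕ; zero; suc; _+_; _*_; _∸_; _≥_; _≤_; _<_; z≤n; s≤s; z<s; s<s; _≤?_; _<?_)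
open import Data.Nat.Properties
open import Data.Nat.Tactic.RingSolver using (solve-∀)
open import Data.Product using (Σ; ∃₂; _×_; _,_; proj₁; proj₂)
open import Data.Sum using (_⊎_; inj₁; inj₂)
open import Function using (_∘_; _⇔_; mk⇔; Equivalence)
open import Relation.Binary.PropositionalEquality
  using (_≡_; _≢_; refl; sym; trans; cong; cong₂; subst; subst₂; module ≡-Reasoning)
open import Relation.Nullary using (Dec; does; yes; no; ¬_; ¬?; contradiction)
open import Relation.Nullary.Decidable using (dec-true; does-⇔; _×-dec_)
open import Algebra.Properties.CommutativeSemigroup +-commutativeSemigroup using (interchange)

open Equivalence using (to; from)

𝟙 : Bool → ℕ
𝟙 b = if b then 1 else 0

𝟙-mono : ∀ {a b} → (a ≡ true → b ≡ true) → 𝟙 a ≤ 𝟙 b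
𝟙-mono {false} _   = z≤n
𝟙-mono {true}  a⇒b rewrite a⇒b refl = ≤-refl

𝟙-false : ∀ {b} → b ≢ true → 𝟙 b ≡ 0
𝟙-false {false} _       = refl
𝟙-false {true}  b≢true = contradiction refl b≢true

𝟙+𝟙-not : ∀ b → 𝟙 b + 𝟙 (not b) ≡ 1
𝟙+𝟙-not true  = refl
𝟙+𝟙-not false = refl

∑ : ℕ → (ℕ → ℕ) → ℕ
∑ zero    f = 0
∑ (suc n) f = f 0 + ∑ n (f ∘ suc)

∑-cong : ∀ n {f g} → (∀ k → k < n → f k ≡ g k) → ∑ n f ≡ ∑ n g
∑-cong zero    f≡g = refl
∑-cong (suc n) f≡g = cong₂ _+_ (f≡g 0 z<s) (∑-cong n (λ k k<n → f≡g (suc k) (s<s k<n)))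

∑-zero : ∀ n {f} → (∀ k → k < n → f k ≡ 0) → ∑ n f ≡ 0
∑-zero zero    f≡0 = refl
∑-zero (suc n) f≡0 = cong₂ _+_ (f≡0 0 z<s) (∑-zero n (λ k k<n → f≡0 (suc k) (s<s k<n)))

∑-const : ∀ n c → ∑ n (λ _ → c) ≡ n * c
∑-const zero    c = refl
∑-const (suc n) c = cong (c +_) (∑-const n c)

∑-+ : ∀ n f g → ∑ n (λ k → f k + g k) ≡ ∑ n f + ∑ n g
∑-+ zero    f g = refl
∑-+ (suc n) f g =
  trans (cong (f 0 + g 0 +_) (∑-+ n (f ∘ suc) (g ∘ suc))) (interchange (f 0) (g 0) _ _)

∑-++ : ∀ u v f → ∑ (u + v) f ≡ ∑ u f + ∑ v (λ k → f (u + k))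
∑-++ zero    v f = refl
∑-++ (suc u) v f = trans (cong (f 0 +_) (∑-++ u v (f ∘ suc))) (sym (+-assoc (f 0) _ _))

∑-+-+ : ∀ u v w f →
        ∑ (u + (v + w)) f ≡ ∑ u f + ∑ v (λ k → f (u + k)) + ∑ w (λ k → f (u + v + k))
∑-+-+ u v w f = begin
  ∑ (u + (v + w)) f
    ≡⟨ ∑-++ u (v + w) f ⟩
  ∑ u f + ∑ (v + w) (λ k → f (u + k))
    ≡⟨ cong (∑ u f +_) (∑-++ v w _) ⟩
  ∑ u f + (∑ v (λ k → f (u + k)) + ∑ w (λ k → f (u + (v + k))))
    ≡⟨ sym (+-assoc (∑ u f) _ _) ⟩
  ∑ u f + ∑ v (λ k → f (u + k)) + ∑ w (λ k → f (u + (v + k)))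
    ≡⟨ cong (∑ u f + ∑ v (λ k → f (u + k)) +_) (∑-cong w (λ k _ → cong f (sym (+-assoc u v k)))) ⟩
  ∑ u f + ∑ v (λ k → f (u + k)) + ∑ w (λ k → f (u + v + k)) ∎
  where open ≡-Reasoning

∑-ends : ∀ u v {f} → (∀ k → k < v → f (u + k) ≡ 0) →
         ∑ (u + (v + u)) f ≡ ∑ u f + ∑ u (λ k → f (u + v + k))
∑-ends u v {f} middle≡0 = begin
  ∑ (u + (v + u)) f
    ≡⟨ ∑-+-+ u v u f ⟩
  ∑ u f + ∑ v (λ k → f (u + k)) + ∑ u (λ k → f (u + v + k))
    ≡⟨ cong (λ z → ∑ u f + z + ∑ u (λ k → f (u + v + k))) (∑-zero v middle≡0) ⟩
  ∑ u f + 0 + ∑ u (λ k → f (u + v + k))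
    ≡⟨ cong (_+ ∑ u (λ k → f (u + v + k))) (+-identityʳ (∑ u f)) ⟩
  ∑ u f + ∑ u (λ k → f (u + v + k)) ∎
  where open ≡-Reasoning

∑-middle : ∀ u v w {f} → (∀ k → k < u → f k ≡ 0) → (∀ k → f (u + v + k) ≡ 0) →
           ∑ (u + (v + w)) f ≡ ∑ v (λ k → f (u + k))
∑-middle u v w {f} below≡0 above≡0 = begin
  ∑ (u + (v + w)) f
    ≡⟨ ∑-+-+ u v w f ⟩
  ∑ u f + ∑ v (λ k → f (u + k)) + ∑ w (λ k → f (u + v + k))
    ≡⟨ cong₂ (λ z z′ → z + ∑ v (λ k → f (u + k)) + z′)
             (∑-zero u below≡0) (∑-zero w (λ k _ → above≡0 k)) ⟩
  ∑ v (λ k → f (u + k)) + 0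
    ≡⟨ +-identityʳ _ ⟩
  ∑ v (λ k → f (u + k)) ∎
  where open ≡-Reasoning

count : ℕ → ℕ → (ℕ → ℕ → Bool) → ℕ
count m n g = ∑ m λ x → ∑ n λ y → 𝟙 (g x y)

count-cong : ∀ m n {g h} → (∀ x y → g x y ≡ h x y) → count m n g ≡ count m n h
count-cong m n g≡h = ∑-cong m (λ x _ → ∑-cong n (λ y _ → cong 𝟙 (g≡h x y)))

count+count-not : ∀ m n g → count m n g + count m n (λ x y → not (g x y)) ≡ m * n
count+count-not m n g = begin
  count m n g + count m n (λ x y → not (g x y))
    ≡⟨ sym (∑-+ m _ _) ⟩
  ∑ m (λ x → ∑ n (λ y → 𝟙 (g x y)) + ∑ n (λ y → 𝟙 (not (g x y))))
    ≡⟨ ∑-cong m (λ x _ → trans (sym (∑-+ n _ _)) (∑-cong n (λ y _ → 𝟙+𝟙-not (g x y)))) ⟩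
  ∑ m (λ _ → ∑ n (λ _ → 1))
    ≡⟨ ∑-cong m (λ _ _ → trans (∑-const n 1) (*-identityʳ n)) ⟩
  ∑ m (λ _ → n)
    ≡⟨ ∑-const m n ⟩
  m * n ∎
  where open ≡-Reasoning

count-window : ∀ a u b c v e {g} →
               (∀ x y → g x y ≡ true → a ≤ x × x < a + u × c ≤ y × y < c + v) →
               count (a + (u + b)) (c + (v + e)) g ≡ count u v (λ x y → g (a + x) (c + y))
count-window a u b c v e {g} inWindow =
  trans (∑-middle a u b (λ x x<a → row≡0 (λ y gxy → <⇒≱ x<a (proj₁ (inWindow x y gxy))))
                        (λ k → row≡0 (λ y gxy → <⇒≱ (proj₁ (proj₂ (inWindow _ y gxy))) (m≤m+n _ k))))
        (∑-cong u (λ x _ → ∑-middle c v e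
           (λ y y<c → 𝟙-false (λ gxy → <⇒≱ y<c (proj₁ (proj₂ (proj₂ (inWindow _ y gxy))))))
           (λ k → 𝟙-false (λ gxy → <⇒≱ (proj₂ (proj₂ (proj₂ (inWindow _ _ gxy)))) (m≤m+n _ k)))))
  where
  row≡0 : ∀ {x} → (∀ y → g x y ≢ true) → ∑ (c + (v + e)) (λ y → 𝟙 (g x y)) ≡ 0
  row≡0 gx≢true = ∑-zero (c + (v + e)) (λ y _ → 𝟙-false (gx≢true y))

countFin≡∑ : ∀ {n} {f : Fin n → Bool} (g : ℕ → Bool) → (∀ k → f k ≡ g (toℕ k)) →
             countFin f ≡ ∑ n (𝟙 ∘ g)
countFin≡∑ {zero}  g f≡g = refl
countFin≡∑ {suc n} g f≡g = cong₂ _+_ (cong 𝟙 (f≡g fzero)) (countFin≡∑ (g ∘ suc) (f≡g ∘ fsuc))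

count2≡count : ∀ {m n} {f : Fin m → Fin n → Bool} (g : ℕ → ℕ → Bool) →
               (∀ i j → f i j ≡ g (toℕ i) (toℕ j)) → count2 f ≡ count m n g
count2≡count {zero}  g f≡g = refl
count2≡count {suc m} g f≡g =
  cong₂ _+_ (countFin≡∑ (g 0) (f≡g fzero)) (count2≡count (g ∘ suc) (f≡g ∘ fsuc))

countFin-mono : ∀ {n} {f g : Fin n → Bool} → (∀ k → f k ≡ true → g k ≡ true) →
                countFin f ≤ countFin g
countFin-mono {zero}  f⊆g = z≤n
countFin-mono {suc n} f⊆g = +-mono-≤ (𝟙-mono (f⊆g fzero)) (countFin-mono (f⊆g ∘ fsuc))

count2-mono : ∀ {m n} {f g : Fin m → Fin n → Bool} →
              (∀ i j → f i j ≡ true → g i j ≡ true) → count2 f ≤ count2 g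
count2-mono {zero}  f⊆g = z≤n
count2-mono {suc m} f⊆g = +-mono-≤ (countFin-mono (f⊆g fzero)) (count2-mono (f⊆g ∘ fsuc))

does⇒witness : ∀ {ℓ} {A : Set ℓ} (a? : Dec A) → does a? ≡ true → A
does⇒witness (yes a) _ = a

-- Some increasing map Fin s → Fin m sends i to x.
Fits : ℕ → ℕ → ℕ → ℕ → Set
Fits m s x i = i ≤ x × x + s ≤ m + i

fits? : ∀ m s x i → Dec (Fits m s x i)
fits? m s x i = (i ≤? x) ×-dec (x + s ≤? m + i)

∘inject₁-increasing : ∀ {s m} (r : Fin (suc s) → Fin m) → Increasing r → Increasing (r ∘ inject₁)
∘inject₁-increasing r r↑ i j i<j =
  r↑ (inject₁ i) (inject₁ j) (subst₂ _<_ (sym (toℕ-inject₁ i)) (sym (toℕ-inject₁ j)) i<j)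

∘fsuc-increasing : ∀ {s m} (r : Fin (suc s) → Fin m) → Increasing r → Increasing (r ∘ fsuc)
∘fsuc-increasing r r↑ i j = r↑ (fsuc i) (fsuc j) ∘ s<s

increasing⇒≤ : ∀ {s m} (r : Fin s → Fin m) → Increasing r → ∀ i → toℕ i ≤ toℕ (r i)
increasing⇒≤ r r↑ fzero    = z≤n
increasing⇒≤ r r↑ (fsuc i) = begin-strict
  toℕ i                ≤⟨ increasing⇒≤ (r ∘ inject₁) (∘inject₁-increasing r r↑) i ⟩
  toℕ (r (inject₁ i))  <⟨ r↑ (inject₁ i) (fsuc i) (s≤s (≤-reflexive (toℕ-inject₁ i))) ⟩
  toℕ (r (fsuc i))     ∎
  where open ≤-Reasoning

increasing⇒room : ∀ {s m} (r : Fin s → Fin m) → Increasing r → ∀ i → toℕ (r i) + s ≤ m + toℕ i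
increasing⇒room {suc zero} {m} r r↑ fzero =
  subst₂ _≤_ (+-comm 1 (toℕ (r fzero))) (sym (+-identityʳ m)) (toℕ<n (r fzero))
increasing⇒room {suc (suc s)} r r↑ fzero = begin
  toℕ (r fzero) + suc (suc s)  ≡⟨ +-suc (toℕ (r fzero)) (suc s) ⟩
  suc (toℕ (r fzero)) + suc s  ≤⟨ +-monoˡ-≤ (suc s) (r↑ fzero (fsuc fzero) z<s) ⟩
  toℕ (r (fsuc fzero)) + suc s ≤⟨ increasing⇒room (r ∘ fsuc) (∘fsuc-increasing r r↑) fzero ⟩
  _                            ∎
  where open ≤-Reasoning
increasing⇒room {suc s} {m} r r↑ (fsuc i) = begin
  toℕ (r (fsuc i)) + suc s    ≡⟨ +-suc (toℕ (r (fsuc i))) s ⟩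
  suc (toℕ (r (fsuc i)) + s)  ≤⟨ s≤s (increasing⇒room (r ∘ fsuc) (∘fsuc-increasing r r↑) i) ⟩
  suc (m + toℕ i)             ≡⟨ +-suc m (toℕ i) ⟨
  m + suc (toℕ i)             ∎
  where open ≤-Reasoning

increasing⇒fits : ∀ {s m} (r : Fin s → Fin m) → Increasing r → ∀ i → Fits m s (toℕ (r i)) (toℕ i)
increasing⇒fits r r↑ i = increasing⇒≤ r r↑ i , increasing⇒room r r↑ i

fits⇒embedding : ∀ {s m} (i : Fin s) (x : Fin m) → Fits m s (toℕ x) (toℕ i) →
                 Σ (Fin s → Fin m) λ r → Increasing r × r i ≡ x
fits⇒embedding {s} {m} i x (i≤x , room) = r , r↑ , ri≡x
  where
  d : ℕ
  d = toℕ x ∸ toℕ i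
  x≡i+d : toℕ x ≡ toℕ i + d
  x≡i+d = sym (m+[n∸m]≡n i≤x)
  d+s≤m : d + s ≤ m
  d+s≤m = +-cancelˡ-≤ (toℕ i) (d + s) m
            (subst₂ _≤_ (trans (cong (_+ s) x≡i+d) (+-assoc (toℕ i) d s)) (+-comm m (toℕ i)) room)
  shifted<m : ∀ k → toℕ k + d < m
  shifted<m k = ≤-trans (+-monoˡ-≤ d (toℕ<n k)) (subst (_≤ m) (+-comm d s) d+s≤m)
  r : Fin s → Fin m
  r k = fromℕ< (shifted<m k)
  r↑ : Increasing r
  r↑ k k′ k<k′ = subst₂ _<_ (sym (toℕ-fromℕ< _)) (sym (toℕ-fromℕ< _)) (+-monoˡ-< d k<k′)
  ri≡x : r i ≡ x
  ri≡x = toℕ-injective (trans (toℕ-fromℕ< _) (sym x≡i+d))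

module _ {s t} (Q : Matrix s t) (m n : ℕ) where

  Forced : ℕ → ℕ → Set
  Forced x y = ∃₂ λ i j → Q i j ≡ true × Fits m s x (toℕ i) × Fits n t y (toℕ j)

  forced? : ∀ x y → Dec (Forced x y)
  forced? x y = any? λ i → any? λ j →
    (Q i j ≟ᵇ true) ×-dec fits? m s x (toℕ i) ×-dec fits? n t y (toℕ j)

  forcedAt : ℕ → ℕ → Bool
  forcedAt x y = does (forced? x y)

  forced : Matrix m n
  forced x y = forcedAt (toℕ x) (toℕ y)

  forced-isForcing : QForcing Q forced
  forced-isForcing r c r↑ c↑ i j qij =
    dec-true (forced? _ _) (i , j , qij , increasing⇒fits r r↑ i , increasing⇒fits c c↑ j)

  forced⊆forcing : ∀ {B} → QForcing Q B → ∀ x y → forced x y ≡ true → B x y ≡ true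
  forced⊆forcing {B} B-forcing x y forced-xy =
    let i , j , qij , i↦x , j↦y = does⇒witness (forced? _ _) forced-xy
        r , r↑ , ri≡x = fits⇒embedding i x i↦x
        c , c↑ , cj≡y = fits⇒embedding j y j↦y
    in subst₂ (λ u v → B u v ≡ true) ri≡x cj≡y (B-forcing r c r↑ c↑ i j qij)

  forced-isMin : IsMinForcing m n Q (ones forced)
  forced-isMin =
    (forced , forced-isForcing , refl) , λ B B-forcing → count2-mono (forced⊆forcing B-forcing)

module Band (p K : ℕ) where

  private
    M : ℕ
    M = p + (K + p)

    p+p≤M : p + p ≤ M
    p+p≤M = +-monoʳ-≤ p (m≤n+m p K)

  fits-top⇔ : ∀ {x i} → x < p → Fits M p x i ⇔ i ≤ x
  fits-top⇔ {x} {i} x<p = mk⇔ proj₁ λ i≤x → i≤x , (begin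
    x + p  ≤⟨ +-monoˡ-≤ p (<⇒≤ x<p) ⟩
    p + p  ≤⟨ p+p≤M ⟩
    M      ≤⟨ m≤m+n M i ⟩
    M + i  ∎)
    where open ≤-Reasoning

  fits-bottom⇔ : ∀ {x i} → i < p → Fits M p (p + K + x) i ⇔ x ≤ i
  fits-bottom⇔ {x} {i} i<p = mk⇔
    (λ (_ , room) → +-cancelˡ-≤ M x i (subst (_≤ M + i) (regroup p K x) room))
    (λ x≤i → ≤-trans (<⇒≤ i<p) (≤-trans (m≤m+n p K) (m≤m+n (p + K) x))
           , subst (_≤ M + i) (sym (regroup p K x)) (+-monoʳ-≤ M x≤i))
    where
    regroup : ∀ p K x → p + K + x + p ≡ p + (K + p) + x
    regroup = solve-∀

  fits-middle : ∀ {x i} → p ≤ x → x + p ≤ M → i < p → Fits M p x i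
  fits-middle p≤x room i<p = ≤-trans (<⇒≤ i<p) p≤x , ≤-trans room (m≤m+n M _)

  middle-room : ∀ {k} → k < K → p + k + p ≤ M
  middle-room {k} k<K = ≤-trans (≤-reflexive (+-assoc p k p)) (+-monoʳ-≤ p (+-monoˡ-≤ p (<⇒≤ k<K)))

  top<M : ∀ {x} → x < p → x < M
  top<M x<p = <-≤-trans x<p (m≤m+n p (K + p))

  bottom<M : ∀ {x} → x < p → p + K + x < M
  bottom<M x<p = <-≤-trans (+-monoʳ-< (p + K) x<p) (≤-reflexive (+-assoc p K p))

  fits-first⊎last : ∀ {x} → 0 < p → x < M → Fits M p x 0 ⊎ Fits M p x (p ∸ 1)
  fits-first⊎last {x} 0<p x<M with x + p ≤? M
  ... | yes room = inj₁ (z≤n , subst (x + p ≤_) (sym (+-identityʳ M)) room)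
  ... | no ¬room = inj₂ (p∸1≤x , room)
    where
    p+p<x+p : p + p < x + p
    p+p<x+p = ≤-<-trans p+p≤M (≰⇒> ¬room)
    p∸1≤x : p ∸ 1 ≤ x
    p∸1≤x = ≤-trans (m∸n≤m p 1) (<⇒≤ (+-cancelʳ-< p p x p+p<x+p))
    room : x + p ≤ M + (p ∸ 1)
    room = begin
      x + p              ≡⟨ cong (x +_) (m+[n∸m]≡n 0<p) ⟨
      x + (1 + (p ∸ 1))  ≡⟨ +-suc x (p ∸ 1) ⟩
      suc x + (p ∸ 1)    ≤⟨ +-monoˡ-≤ (p ∸ 1) x<M ⟩
      M + (p ∸ 1)        ∎
      where open ≤-Reasoning

Tight : ∀ {p q} → Matrix p q → Set
Tight {p} {q} R =
  (∃₂ λ i j → toℕ i ≡ 0 × R i j ≡ true) × (∃₂ λ i j → toℕ i ≡ p ∸ 1 × R i j ≡ true) ×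
  (∃₂ λ i j → toℕ j ≡ 0 × R i j ≡ true) × (∃₂ λ i j → toℕ j ≡ q ∸ 1 × R i j ≡ true)

tight⇒0<rows : ∀ {p q} {R : Matrix p q} → Tight R → 0 < p
tight⇒0<rows ((i , _) , _) = ≤-<-trans z≤n (toℕ<n i)

tight⇒0<columns : ∀ {p q} {R : Matrix p q} → Tight R → 0 < q
tight⇒0<columns ((_ , j , _) , _) = ≤-<-trans z≤n (toℕ<n j)

module _ {p q} (R : Matrix p q) (M N : ℕ) where

  Blank : (Fin p → Set) → (Fin q → Set) → Set
  Blank ρ κ = ∀ i j → ρ i → κ j → R i j ≡ false

  corner⇔unforced : ∀ {x y ρ κ I J} → ρ I → κ J →
                    (∀ i → Fits M p x (toℕ i) ⇔ ρ i) → (∀ j → Fits N q y (toℕ j) ⇔ κ j) →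
                    (R I J ≡ false × Blank ρ κ) ⇔ (¬ Forced R M N x y)
  corner⇔unforced {I = I} {J} ρI κJ fits⇔ρ fits⇔κ = mk⇔
    (λ (_ , blank) (i , j , Rij , i↦x , j↦y) →
       contradiction (trans (sym Rij) (blank i j (to (fits⇔ρ i) i↦x) (to (fits⇔κ j) j↦y))) λ ())
    (λ unforced → let blank = λ i j ρi κj → ¬-not λ Rij →
                        unforced (i , j , Rij , from (fits⇔ρ i) ρi , from (fits⇔κ j) κj)
                  in blank I J ρI κJ , blank)

  corner-does : ∀ {x y ρ κ I J} → ρ I → κ J →
                (∀ i → Fits M p x (toℕ i) ⇔ ρ i) → (∀ j → Fits N q y (toℕ j) ⇔ κ j) →
                (d : Dec (R I J ≡ false × Blank ρ κ)) → does d ≡ not (forcedAt R M N x y)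
  corner-does ρI κJ fits⇔ρ fits⇔κ d =
    does-⇔ (corner⇔unforced ρI κJ fits⇔ρ fits⇔κ) d (¬? (forced? R M N _ _))

module Window {p q} (R : Matrix p q) (tight : Tight R) (K L : ℕ) where

  M N : ℕ
  M = p + (K + p)
  N = q + (L + q)

  private
    module Rows = Band p K
    module Cols = Band q L

    top : ∃₂ λ i j → toℕ i ≡ 0 × R i j ≡ true
    top = proj₁ tight
    bottom : ∃₂ λ i j → toℕ i ≡ p ∸ 1 × R i j ≡ true
    bottom = proj₁ (proj₂ tight)
    left : ∃₂ λ i j → toℕ j ≡ 0 × R i j ≡ true
    left = proj₁ (proj₂ (proj₂ tight))
    right : ∃₂ λ i j → toℕ j ≡ q ∸ 1 × R i j ≡ true
    right = proj₂ (proj₂ (proj₂ tight))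

  forced-middle-row : ∀ {x y} → p ≤ x → x + p ≤ M → y < N → Forced R M N x y
  forced-middle-row p≤x room y<N with Cols.fits-first⊎last (tight⇒0<columns tight) y<N
  ... | inj₁ y↤first = let i , j , j≡first , Rij = left in
        i , j , Rij , Rows.fits-middle p≤x room (toℕ<n i) , subst (Fits N q _) (sym j≡first) y↤first
  ... | inj₂ y↤last  = let i , j , j≡last , Rij = right in
        i , j , Rij , Rows.fits-middle p≤x room (toℕ<n i) , subst (Fits N q _) (sym j≡last) y↤last

  forced-middle-column : ∀ {x y} → x < M → q ≤ y → y + q ≤ N → Forced R M N x y
  forced-middle-column x<M q≤y room with Rows.fits-first⊎last (tight⇒0<rows tight) x<M
  ... | inj₁ x↤first = let i , j , i≡first , Rij = top in
        i , j , Rij , subst (Fits M p _) (sym i≡first) x↤first , Cols.fits-middle q≤y room (toℕ<n j)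
  ... | inj₂ x↤last  = let i , j , i≡last , Rij = bottom in
        i , j , Rij , subst (Fits M p _) (sym i≡last) x↤last , Cols.fits-middle q≤y room (toℕ<n j)

  unforced : ℕ → ℕ → Bool
  unforced x y = not (forcedAt R M N x y)

  forced⇒𝟙-unforced≡0 : ∀ {x y} → Forced R M N x y → 𝟙 (unforced x y) ≡ 0
  forced⇒𝟙-unforced≡0 forced-xy = cong (𝟙 ∘ not) (dec-true (forced? R M N _ _) forced-xy)

  nw : ∀ I J → does (NW? R I J) ≡ unforced (toℕ I) (toℕ J)
  nw I J = corner-does R M N ≤-refl ≤-refl
    (λ _ → Rows.fits-top⇔ (toℕ<n I)) (λ _ → Cols.fits-top⇔ (toℕ<n J)) (NW? R I J)

  ne : ∀ I J → does (NE? R I J) ≡ unforced (toℕ I) (q + L + toℕ J)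
  ne I J = corner-does R M N ≤-refl ≤-refl
    (λ _ → Rows.fits-top⇔ (toℕ<n I)) (λ j → Cols.fits-bottom⇔ (toℕ<n j)) (NE? R I J)

  sw : ∀ I J → does (SW? R I J) ≡ unforced (p + K + toℕ I) (toℕ J)
  sw I J = corner-does R M N ≤-refl ≤-refl
    (λ i → Rows.fits-bottom⇔ (toℕ<n i)) (λ _ → Cols.fits-top⇔ (toℕ<n J)) (SW? R I J)

  se : ∀ I J → does (SE? R I J) ≡ unforced (p + K + toℕ I) (q + L + toℕ J)
  se I J = corner-does R M N ≤-refl ≤-refl
    (λ i → Rows.fits-bottom⇔ (toℕ<n i)) (λ j → Cols.fits-bottom⇔ (toℕ<n j)) (SE? R I J)

  row : ℕ → ℕ
  row x = ∑ N (λ y → 𝟙 (unforced x y))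

  middle-row≡0 : ∀ k → k < K → row (p + k) ≡ 0
  middle-row≡0 k k<K = ∑-zero N λ y y<N →
    forced⇒𝟙-unforced≡0 (forced-middle-row (m≤m+n p k) (Rows.middle-room k<K) y<N)

  row≡corners : ∀ {x} → x < M →
                row x ≡ ∑ q (λ y → 𝟙 (unforced x y)) + ∑ q (λ y → 𝟙 (unforced x (q + L + y)))
  row≡corners x<M = ∑-ends q L λ l l<L →
    forced⇒𝟙-unforced≡0 (forced-middle-column x<M (m≤m+n q l) (Cols.middle-room l<L))

  count-unforced : count M N unforced ≡ cornerSum R
  count-unforced = begin
    ∑ M row
      ≡⟨ ∑-ends p K middle-row≡0 ⟩
    ∑ p row + ∑ p (λ x → row (p + K + x))
      ≡⟨ cong₂ _+_ (∑-cong p λ _ x<p → row≡corners (Rows.top<M x<p))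
                   (∑-cong p λ _ x<p → row≡corners (Rows.bottom<M x<p)) ⟩
    ∑ p (λ x → ∑ q (λ y → 𝟙 (unforced x y)) + ∑ q (λ y → 𝟙 (unforced x (q + L + y)))) +
    ∑ p (λ x → ∑ q (λ y → 𝟙 (unforced (p + K + x) y))
             + ∑ q (λ y → 𝟙 (unforced (p + K + x) (q + L + y))))
      ≡⟨ cong₂ _+_ (∑-+ p _ _) (∑-+ p _ _) ⟩
    (#nw + #ne) + (#sw + #se)
      ≡⟨ regroup #nw #ne #sw #se ⟩
    #nw + #sw + #ne + #se
      ≡⟨ cong₂ _+_ (cong₂ _+_ (cong₂ _+_ (count2≡count _ nw) (count2≡count _ sw))
                             (count2≡count _ ne))
                   (count2≡count _ se) ⟨
    cornerSum R ∎
    where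
    open ≡-Reasoning
    #nw #ne #sw #se : ℕ
    #nw = count p q unforced
    #ne = count p q (λ x y → unforced x (q + L + y))
    #sw = count p q (λ x y → unforced (p + K + x) y)
    #se = count p q (λ x y → unforced (p + K + x) (q + L + y))
    regroup : ∀ a b c d → (a + b) + (c + d) ≡ a + c + b + d
    regroup = solve-∀

  ones-forced : ones (forced R M N) ≡ M * N ∸ cornerSum R
  ones-forced = begin
    ones (forced R M N)
      ≡⟨ count2≡count {M} {N} (forcedAt R M N) (λ _ _ → refl) ⟩
    count M N (forcedAt R M N)
      ≡⟨ m+n∸n≡m _ (count M N unforced) ⟨
    count M N (forcedAt R M N) + count M N unforced ∸ count M N unforced
      ≡⟨ cong₂ _∸_ (count+count-not M N (forcedAt R M N)) count-unforced ⟩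
    M * N ∸ cornerSum R ∎
    where open ≡-Reasoning

ones-forced-tight : ∀ {p q} {R : Matrix p q} → Tight R → ∀ {M N} → 2 * p ≤ M → 2 * q ≤ N →
                    ones (forced R M N) ≡ M * N ∸ cornerSum R
ones-forced-tight {p} {q} {R} tight {M} {N} 2p≤M 2q≤N =
  subst₂ (λ M N → ones (forced R M N) ≡ M * N ∸ cornerSum R) (split p 2p≤M) (split q 2q≤N)
         (Window.ones-forced R tight (M ∸ 2 * p) (N ∸ 2 * q))
  where
  split : ∀ u {W} → 2 * u ≤ W → u + (W ∸ 2 * u + u) ≡ W
  split u {W} 2u≤W = trans (regroup u (W ∸ 2 * u)) (m∸n+n≡m 2u≤W)
    where
    regroup : ∀ u k → u + (k + u) ≡ k + 2 * u
    regroup = solve-∀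

entryℕ-toℕ : ∀ {s t} (Q : Matrix s t) i j → entryℕ Q (toℕ i) (toℕ j) ≡ Q i j
entryℕ-toℕ {s} {t} Q i j with toℕ i <? s | toℕ j <? t
... | yes i<s | yes j<t = cong₂ Q (fromℕ<-toℕ i i<s) (fromℕ<-toℕ j j<t)
... | yes _   | no j≮t  = contradiction (toℕ<n j) j≮t
... | no i≮s  | _       = contradiction (toℕ<n i) i≮s

entryℕ-true : ∀ {s t} (Q : Matrix s t) {x y} → entryℕ Q x y ≡ true →
              ∃₂ λ i j → toℕ i ≡ x × toℕ j ≡ y × Q i j ≡ true
entryℕ-true {s} {t} Q {x} {y} e with x <? s | y <? t
... | yes x<s | yes y<t = fromℕ< x<s , fromℕ< y<t , toℕ-fromℕ< x<s , toℕ-fromℕ< y<t , e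

offset : ∀ {a k p} → a ≤ k → k < a + p → Σ (Fin p) λ I → k ≡ a + toℕ I
offset {a} {k} {p} a≤k k<a+p =
  fromℕ< k∸a<p , trans (sym (m+[n∸m]≡n a≤k)) (cong (a +_) (sym (toℕ-fromℕ< k∸a<p)))
  where
  k∸a<p : k ∸ a < p
  k∸a<p = +-cancelˡ-< a (k ∸ a) p (subst (_< a + p) (sym (m+[n∸m]≡n a≤k)) k<a+p)

fits-shift : ∀ {s S M p a x i} → s ≡ S + p → Fits (S + M) s (a + x) (a + i) ⇔ Fits M p x i
fits-shift {S = S} {M} {p} {a} {x} {i} refl = mk⇔
  (λ (a+i≤a+x , room) → +-cancelˡ-≤ a i x a+i≤a+x
                       , +-cancelˡ-≤ (a + S) (x + p) (M + i) (subst₂ _≤_ lhs rhs room))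
  (λ (i≤x , room) → +-monoʳ-≤ a i≤x , subst₂ _≤_ (sym lhs) (sym rhs) (+-monoʳ-≤ (a + S) room))
  where
  regroupₗ : ∀ a x S p → a + x + (S + p) ≡ a + S + (x + p)
  regroupₗ = solve-∀
  regroupᵣ : ∀ S M a i → S + M + (a + i) ≡ a + S + (M + i)
  regroupᵣ = solve-∀
  lhs : a + x + (S + p) ≡ a + S + (x + p)
  lhs = regroupₗ a x S p
  rhs : S + M + (a + i) ≡ a + S + (M + i)
  rhs = regroupᵣ S M a i

fits⇒below : ∀ {s S M p a x i} → s ≡ S + p → Fits (S + M) s x i → i < a + p → x < a + M
fits⇒below {S = S} {M} {p} {a} {x} {i} refl (_ , room) i<a+p =
  +-cancelʳ-< (S + p) x (a + M) (begin-strict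
    x + (S + p)      ≤⟨ room ⟩
    S + M + i        <⟨ +-monoʳ-< (S + M) i<a+p ⟩
    S + M + (a + p)  ≡⟨ regroup S M a p ⟩
    a + M + (S + p)  ∎)
  where
  open ≤-Reasoning
  regroup : ∀ S M a p → S + M + (a + p) ≡ a + M + (S + p)
  regroup = solve-∀

module CoreReduction {s t} {Q : Matrix s t} {a c p q : ℕ} (core : IsCore Q a c p q) (M N : ℕ) where

  S T : ℕ
  S = s ∸ p
  T = t ∸ q

  R : Matrix p q
  R = block Q a c p q

  private
    a+p≤s : a + p ≤ s
    a+p≤s = proj₁ core
    c+q≤t : c + q ≤ t
    c+q≤t = proj₁ (proj₂ core)
    inside : ∀ i j → Q i j ≡ true → a ≤ toℕ i × toℕ i < a + p × c ≤ toℕ j × toℕ j < c + q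
    inside = proj₁ (proj₂ (proj₂ core))

    s≡S+p : s ≡ S + p
    s≡S+p = sym (m∸n+n≡m (≤-trans (m≤n+m p a) a+p≤s))

    t≡T+q : t ≡ T + q
    t≡T+q = sym (m∸n+n≡m (≤-trans (m≤n+m q c) c+q≤t))

  Q-entry⇒R-entry : ∀ {i₀ j₀} → Q i₀ j₀ ≡ true →
                    ∃₂ λ I J → toℕ i₀ ≡ a + toℕ I × toℕ j₀ ≡ c + toℕ J × R I J ≡ true
  Q-entry⇒R-entry {i₀} {j₀} Qij =
    let a≤i , i<a+p , c≤j , j<c+q = inside i₀ j₀ Qij
        I , i≡ = offset a≤i i<a+p
        J , j≡ = offset c≤j j<c+q
    in I , J , i≡ , j≡
     , subst₂ (λ u v → entryℕ Q u v ≡ true) i≡ j≡ (trans (entryℕ-toℕ Q i₀ j₀) Qij)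

  forced⇔ : ∀ x y → Forced Q (S + M) (T + N) (a + x) (c + y) ⇔ Forced R M N x y
  forced⇔ x y = mk⇔
    (λ (i₀ , j₀ , Qij , i₀↦ , j₀↦) →
       let I , J , i≡ , j≡ , RIJ = Q-entry⇒R-entry Qij
       in I , J , RIJ , to (fits-shift s≡S+p) (subst (Fits _ s (a + x)) i≡ i₀↦)
                      , to (fits-shift t≡T+q) (subst (Fits _ t (c + y)) j≡ j₀↦))
    (λ (I , J , RIJ , I↦ , J↦) →
       let i₀ , j₀ , i≡ , j≡ , Qij = entryℕ-true Q RIJ
       in i₀ , j₀ , Qij , subst (Fits _ s (a + x)) (sym i≡) (from (fits-shift s≡S+p) I↦)
                        , subst (Fits _ t (c + y)) (sym j≡) (from (fits-shift t≡T+q) J↦))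

  forced⇒inWindow : ∀ x y → forcedAt Q (S + M) (T + N) x y ≡ true →
                    a ≤ x × x < a + M × c ≤ y × y < c + N
  forced⇒inWindow x y forced-xy =
    let i₀ , j₀ , Qij , i₀↦ , j₀↦ = does⇒witness (forced? Q _ _ x y) forced-xy
        a≤i , i<a+p , c≤j , j<c+q = inside i₀ j₀ Qij
    in ≤-trans a≤i (proj₁ i₀↦) , fits⇒below {S = S} {M} {p} {a} s≡S+p i₀↦ i<a+p
     , ≤-trans c≤j (proj₁ j₀↦) , fits⇒below {S = T} {N} {q} {c} t≡T+q j₀↦ j<c+q

  ones-forced-core : ones (forced Q (S + M) (T + N)) ≡ ones (forced R M N)
  ones-forced-core = begin
    ones (forced Q (S + M) (T + N))
      ≡⟨ count2≡count {S + M} {T + N} F (λ _ _ → refl) ⟩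
    count (S + M) (T + N) F
      ≡⟨ cong₂ (λ u v → count u v F) (around a p M a+p≤s) (around c q N c+q≤t) ⟩
    count (a + (M + (S ∸ a))) (c + (N + (T ∸ c))) F
      ≡⟨ count-window a M (S ∸ a) c N (T ∸ c) forced⇒inWindow ⟩
    count M N (λ x y → F (a + x) (c + y))
      ≡⟨ count-cong M N (λ x y → does-⇔ (forced⇔ x y) (forced? Q _ _ _ _) (forced? R M N x y)) ⟩
    count M N (forcedAt R M N)
      ≡⟨ count2≡count {M} {N} (forcedAt R M N) (λ _ _ → refl) ⟨
    ones (forced R M N) ∎
    where
    open ≡-Reasoning
    F : ℕ → ℕ → Bool
    F = forcedAt Q (S + M) (T + N)
    around : ∀ a p K {s} → a + p ≤ s → s ∸ p + K ≡ a + (K + (s ∸ p ∸ a))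
    around a p K {s} a+p≤s = begin
      s ∸ p + K                ≡⟨ cong (_+ K) (m+[n∸m]≡n (m+n≤o⇒m≤o∸n a a+p≤s)) ⟨
      a + (s ∸ p ∸ a) + K      ≡⟨ +-assoc a (s ∸ p ∸ a) K ⟩
      a + (s ∸ p ∸ a + K)      ≡⟨ cong (a +_) (+-comm (s ∸ p ∸ a) K) ⟩
      a + (K + (s ∸ p ∸ a))    ∎

isCore⇒tight : ∀ {s t} {Q : Matrix s t} {a c p q} → IsCore Q a c p q → Tight (block Q a c p q)
isCore⇒tight {Q = Q} {a} {c} {p} {q}
  (_ , _ , _ , (j , j<q , Q-top) , (j′ , j′<q , Q-bottom)
             , (i , i<p , Q-left) , (i′ , i′<p , Q-right)) =
    in-row 0<p j<q (subst (λ u → entryℕ Q u (c + j) ≡ true) (sym (+-identityʳ a)) Q-top)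
  , in-row (∸1< 0<p) j′<q Q-bottom
  , in-column i<p 0<q (subst (λ v → entryℕ Q (a + i) v ≡ true) (sym (+-identityʳ c)) Q-left)
  , in-column i′<p (∸1< 0<q) Q-right
  where
  0<p : 0 < p
  0<p = ≤-<-trans z≤n i<p
  0<q : 0 < q
  0<q = ≤-<-trans z≤n j<q
  ∸1< : ∀ {n} → 0 < n → n ∸ 1 < n
  ∸1< {suc n} _ = n<1+n n
  R-entry : ∀ {x y} (x<p : x < p) (y<q : y < q) → entryℕ Q (a + x) (c + y) ≡ true →
            block Q a c p q (fromℕ< x<p) (fromℕ< y<q) ≡ true
  R-entry x<p y<q = subst₂ (λ u v → entryℕ Q (a + u) (c + v) ≡ true)
                           (sym (toℕ-fromℕ< x<p)) (sym (toℕ-fromℕ< y<q))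
  in-row : ∀ {x y} → x < p → y < q → entryℕ Q (a + x) (c + y) ≡ true →
           ∃₂ λ I J → toℕ I ≡ x × block Q a c p q I J ≡ true
  in-row x<p y<q e = fromℕ< x<p , fromℕ< y<q , toℕ-fromℕ< x<p , R-entry x<p y<q e
  in-column : ∀ {x y} → x < p → y < q → entryℕ Q (a + x) (c + y) ≡ true →
              ∃₂ λ I J → toℕ J ≡ y × block Q a c p q I J ≡ true
  in-column x<p y<q e = fromℕ< x<p , fromℕ< y<q , toℕ-fromℕ< y<q , R-entry x<p y<q e

m≡n+[m∸n] : ∀ m n {k} → 0 < k → k ≤ m ∸ n → m ≡ n + (m ∸ n)
m≡n+[m∸n] m n {k} 0<k k≤m∸n =
  sym (m+[n∸m]≡n {n} {m} (<⇒≤ (m∸n≢0⇒n<m λ m∸n≡0 → <⇒≱ 0<k (subst (k ≤_) m∸n≡0 k≤m∸n))))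

theorem2 : ∀ {s t} (Q : Matrix s t) → NonZero Q →
    (a c s' t' : ℕ) → IsCore Q a c s' t' →
    (m n : ℕ) → m ∸ (s ∸ s') ≥ 2 * s' → n ∸ (t ∸ t') ≥ 2 * t' →
    IsMinForcing m n Q
      ((m ∸ (s ∸ s')) * (n ∸ (t ∸ t')) ∸ cornerSum (block Q a c s' t'))
theorem2 {s} {t} Q _ a c s' t' core m n 2s′≤M 2t′≤N =
  subst (IsMinForcing m n Q) ones-forced≡ (forced-isMin Q m n)
  where
  open CoreReduction core (m ∸ (s ∸ s')) (n ∸ (t ∸ t'))
  tight : Tight R
  tight = isCore⇒tight core
  ones-forced≡ : ones (forced Q m n) ≡ (m ∸ S) * (n ∸ T) ∸ cornerSum R
  ones-forced≡ = begin
    ones (forced Q m n)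
      ≡⟨ cong₂ (λ u v → ones (forced Q u v))
               (m≡n+[m∸n] m S (≤-trans (tight⇒0<rows tight) (m≤m+n s' _)) 2s′≤M)
               (m≡n+[m∸n] n T (≤-trans (tight⇒0<columns tight) (m≤m+n t' _)) 2t′≤N) ⟩
    ones (forced Q (S + (m ∸ S)) (T + (n ∸ T)))  ≡⟨ ones-forced-core ⟩
    ones (forced R (m ∸ S) (n ∸ T))              ≡⟨ ones-forced-tight tight 2s′≤M 2t′≤N ⟩
    (m ∸ S) * (n ∸ T) ∸ cornerSum R              ∎
    where open ≡-Reasoning
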